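{- Let $n \ge k \ge 3$ be integers. Then $(K_n,k)$ is niche-realizable if and only if $(n,k)=(4,4)$ or $n\ge 5$.
   Context: $K_n$ is the complete graph on $n$ vertices. A $k$-partite tournament is an orientation of a complete $k$-partite graph with $k$ nonempty partite sets. The niche graph $\mathcal{N}(D)$ of a digraph $D$ has vertex set $V(D)$, and two distinct vertices are adjacent iff they have a common out-neighbor in $D$ or a common in-neighbor in $D$. The pair $(G,k)$ is niche-realizable if $G$ is isomorphic to the niche graph of some $k$-partite tournament. -}

module Defs where

open import Data.Nat using (ℕ)
open import Data.Fin using (Fin)
open import Data.Bool using (Bool; true)
open import Data.Product using (Σ; ∃; _×_; Σ-syntax; ∃-syntax)
open import Data.Sum using (_⊎_)
open import Relation.Nullary using (¬_)
open import Relation.Binary.PropositionalEquality using (_≡_; _≢_)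
open import Function.Bundles using (_↔_; Inverse; _⇔_)

Graph : Set → Set₁
Graph V = V → V → Set

record _≅_ {V W : Set} (G : Graph V) (H : Graph W) : Set where
  field
    bij      : V ↔ W
    preserve : ∀ u v → G u v ⇔ H (Inverse.to bij u) (Inverse.to bij v)

K : (n : ℕ) → Graph (Fin n)
K n u v = u ≢ v

Digraph : ℕ → Set
Digraph m = Fin m → Fin m → Bool

-- A k-partite tournament on m vertices: an orientation of a complete k-partite
-- graph whose k partite sets (fibres of `part`) are all nonempty.
record KPartiteTournament (m k : ℕ) : Set where
  field
    arc      : Digraph m
    part     : Fin m → Fin k
    nonempty : ∀ (i : Fin k) → ∃[ v ] part v ≡ i
    noArcIn  : ∀ u v → part u ≡ part v → ¬ (arc u v ≡ true)
    oriented : ∀ u v → part u ≢ part v → (arc u v ≡ true) ⊎ (arc v u ≡ true)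
    antisym  : ∀ u v → arc u v ≡ true → ¬ (arc v u ≡ true)

Niche : {m : ℕ} → Digraph m → Graph (Fin m)
Niche {m} D u v =
  u ≢ v ×
  ((∃[ w ] (D u w ≡ true × D v w ≡ true)) ⊎ (∃[ w ] (D w u ≡ true × D w v ≡ true)))

NicheRealizable : {V : Set} → Graph V → ℕ → Set
NicheRealizable G k =
  Σ[ m ∈ ℕ ] Σ[ D ∈ KPartiteTournament m k ] (Niche (KPartiteTournament.arc D) ≅ G)

-- A niche-realization of K_n by a k-partite tournament is a k-partite tournament on
-- n vertices in which any two vertices have a common in- or out-neighbour.  Adding to
-- a sinkless tournament a new partite set {s} with s dominating everything yields
-- such a tournament: old pairs share the in-neighbour s, and s meets each v at an
-- out-neighbour of v.  Starting from the directed 3-cycle (adding sources keeps it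
-- sinkless) this covers k ≥ 4 with n = k, and from the bipartite directed 4-cycle it
-- covers k = 3 with n = 5; further vertices are added as clones of an existing one.
-- Conversely, an exhaustive search shows that no antisymmetric digraph on 3 vertices
-- works, and that on 4 vertices only those with all pairs adjacent do, which excludes
-- 3-partite tournaments on 4 vertices.
module Submission where

open import Defs
open import Level using (0ℓ)
open import Data.Bool using (Bool; true; false)
open import Data.Bool.Properties using (¬-not) renaming (_≟_ to _≟ᵇ_)
open import Data.Empty using (⊥-elim)
open import Data.Fin using (Fin; zero; suc; toℕ; _≟_; punchIn; punchOut; splitAt; _↑ˡ_)
open import Data.Fin.Properties using (all?; any?; punchInᵢ≢i; punchIn-punchOut; splitAt-↑ˡ; pigeonhole; <⇒≢; suc-injective)
open import Data.Fin.Permutation using (↔⇒≡)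
open import Data.Nat using (ℕ; zero; suc; _+_; _≤_; _<_; _%_; _≡ᵇ_; z≤n; s≤s; NonZero)
open import Data.Nat.DivMod using (_mod_)
open import Data.Nat.Properties using (m≤n⇒∃[o]m+o≡n)
open import Data.Product using (_×_; _,_; proj₁; proj₂; Σ-syntax; ∃-syntax)
open import Data.Sum using (_⊎_; inj₁; inj₂; [_,_]′)
open import Data.Vec using (Vec; []; _∷_; lookup; tabulate)
open import Data.Vec.Properties using (lookup∘tabulate)
open import Function using (_∘_; _on_; id; const)
open import Function.Bundles using (_⇔_; mk⇔; Injection; Equivalence)
open import Function.Construct.Identity using (↔-id)
open import Function.Properties.Inverse using (↔⇒↣)
open import Relation.Binary.PropositionalEquality using (_≡_; _≢_; refl; sym; trans; cong; subst; ≢-sym; module ≡-Reasoning)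
open import Relation.Nullary using (¬_)
open import Relation.Nullary.Decidable using (Dec; yes; no; map′; True; toWitness; from-yes; ¬?; _×-dec_; _⊎-dec_; _→-dec_)
open import Relation.Unary using (Pred; Decidable)

module _ {m : ℕ} (D : Digraph m) where

  CommonNeighbour : Fin m → Fin m → Set
  CommonNeighbour u v =
    (∃[ w ] (D u w ≡ true × D v w ≡ true)) ⊎ (∃[ w ] (D w u ≡ true × D w v ≡ true))

  NicheComplete : Set
  NicheComplete = ∀ u v → u ≢ v → CommonNeighbour u v

  Antisymmetric : Set
  Antisymmetric = ∀ u v → D u v ≡ true → ¬ D v u ≡ true

  Semicomplete : Set
  Semicomplete = ∀ u v → u ≢ v → D u v ≡ true ⊎ D v u ≡ true

  Sinkless : Set
  Sinkless = ∀ u → ∃[ w ] D u w ≡ true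

  arc? : ∀ u v → Dec (D u v ≡ true)
  arc? u v = D u v ≟ᵇ true

  commonNeighbour? : ∀ u v → Dec (CommonNeighbour u v)
  commonNeighbour? u v =
    any? (λ w → arc? u w ×-dec arc? v w) ⊎-dec any? (λ w → arc? w u ×-dec arc? w v)

  nicheComplete? : Dec NicheComplete
  nicheComplete? = all? λ u → all? λ v → ¬? (u ≟ v) →-dec commonNeighbour? u v

  antisymmetric? : Dec Antisymmetric
  antisymmetric? = all? λ u → all? λ v → arc? u v →-dec ¬? (arc? v u)

  semicomplete? : Dec Semicomplete
  semicomplete? = all? λ u → all? λ v → ¬? (u ≟ v) →-dec (arc? u v ⊎-dec arc? v u)

  sinkless? : Dec Sinkless
  sinkless? = all? λ u → any? λ w → arc? u w

NicheCompleteTournament : ℕ → ℕ → Set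
NicheCompleteTournament m k =
  Σ[ T ∈ KPartiteTournament m k ] NicheComplete (KPartiteTournament.arc T)

SinklessTournament : ℕ → ℕ → Set
SinklessTournament m k =
  Σ[ T ∈ KPartiteTournament m k ] Sinkless (KPartiteTournament.arc T)

module _ {m : ℕ} {D E : Digraph m} (D≗E : ∀ u v → D u v ≡ E u v) where

  antisymmetric-resp : Antisymmetric D → Antisymmetric E
  antisymmetric-resp anti u v p q =
    anti u v (trans (D≗E u v) p) (trans (D≗E v u) q)

  commonNeighbour-resp : ∀ {u v} → CommonNeighbour D u v → CommonNeighbour E u v
  commonNeighbour-resp {u} {v} (inj₁ (w , p , q)) =
    inj₁ (w , trans (sym (D≗E u w)) p , trans (sym (D≗E v w)) q)
  commonNeighbour-resp {u} {v} (inj₂ (w , p , q)) =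
    inj₂ (w , trans (sym (D≗E w u)) p , trans (sym (D≗E w v)) q)

  nicheComplete-resp : NicheComplete D → NicheComplete E
  nicheComplete-resp complete u v u≢v = commonNeighbour-resp (complete u v u≢v)

  semicomplete-resp : Semicomplete D → Semicomplete E
  semicomplete-resp semi u v u≢v with semi u v u≢v
  ... | inj₁ p = inj₁ (trans (sym (D≗E u v)) p)
  ... | inj₂ q = inj₂ (trans (sym (D≗E v u)) q)

Exhaustible : Set → Set₁
Exhaustible A = ∀ {P : Pred A 0ℓ} → Decidable P → Dec (∀ x → P x)

exhaustible-Bool : Exhaustible Bool
exhaustible-Bool P? =
  map′ (λ { (p , _) true → p ; (_ , q) false → q }) (λ h → h true , h false)
       (P? true ×-dec P? false)

exhaustible-Vec : ∀ {A} → Exhaustible A → ∀ r → Exhaustible (Vec A r)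
exhaustible-Vec exhaust zero P? = map′ (λ { p [] → p }) (λ h → h []) (P? [])
exhaustible-Vec exhaust (suc r) P? =
  map′ (λ { h (x ∷ xs) → h x xs }) (λ h x xs → h (x ∷ xs))
       (exhaust λ x → exhaustible-Vec exhaust r (P? ∘ (x ∷_)))

-- Row u lists the arcs from u to the other vertices, indexed through punchIn u,
-- so only loopless digraphs are enumerated.
fromRows : ∀ {m} → Vec (Vec Bool m) (suc m) → Digraph (suc m)
fromRows rows u v with u ≟ v
... | yes _   = false
... | no u≢v = lookup (lookup rows u) (punchOut u≢v)

toRows : ∀ {m} → Digraph (suc m) → Vec (Vec Bool m) (suc m)
toRows D = tabulate λ u → tabulate λ j → D u (punchIn u j)

antisymmetric⇒loopless : ∀ {m} {D : Digraph m} → Antisymmetric D → ∀ u → D u u ≡ false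
antisymmetric⇒loopless anti u = ¬-not λ loop → anti u u loop loop

fromRows-toRows : ∀ {m} (D : Digraph (suc m)) → (∀ u → D u u ≡ false) →
                  ∀ u v → D u v ≡ fromRows (toRows D) u v
fromRows-toRows D loopless u v with u ≟ v
... | yes refl = loopless u
... | no u≢v   = sym (begin
  lookup (lookup (toRows D) u) (punchOut u≢v)
    ≡⟨ cong (λ row → lookup row (punchOut u≢v))
            (lookup∘tabulate (λ u → tabulate λ j → D u (punchIn u j)) u) ⟩
  lookup (tabulate λ j → D u (punchIn u j)) (punchOut u≢v)
    ≡⟨ lookup∘tabulate _ (punchOut u≢v) ⟩
  D u (punchIn u (punchOut u≢v))
    ≡⟨ cong (D u) (punchIn-punchOut u≢v) ⟩
  D u v ∎)
  where open ≡-Reasoning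

exhaustible-Rows : ∀ m → Exhaustible (Vec (Vec Bool m) (suc m))
exhaustible-Rows m = exhaustible-Vec (exhaustible-Vec exhaustible-Bool m) (suc m)

antisymmetric⇒¬nicheComplete₃ : (D : Digraph 3) → Antisymmetric D → ¬ NicheComplete D
antisymmetric⇒¬nicheComplete₃ D anti complete =
  noneOnRows (toRows D) (antisymmetric-resp D≗rows anti) (nicheComplete-resp D≗rows complete)
  where
  D≗rows = fromRows-toRows D (antisymmetric⇒loopless anti)
  noneOnRows : ∀ rows → Antisymmetric (fromRows rows) → ¬ NicheComplete (fromRows rows)
  noneOnRows = from-yes (exhaustible-Rows 2 λ rows →
    antisymmetric? (fromRows rows) →-dec ¬? (nicheComplete? (fromRows rows)))

antisymmetric∧nicheComplete⇒semicomplete₄ : (D : Digraph 4) →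
  Antisymmetric D → NicheComplete D → Semicomplete D
antisymmetric∧nicheComplete⇒semicomplete₄ D anti complete =
  semicomplete-resp (λ u v → sym (D≗rows u v))
    (allOnRows (toRows D) (antisymmetric-resp D≗rows anti) (nicheComplete-resp D≗rows complete))
  where
  D≗rows = fromRows-toRows D (antisymmetric⇒loopless anti)
  allOnRows : ∀ rows → Antisymmetric (fromRows rows) → NicheComplete (fromRows rows) →
              Semicomplete (fromRows rows)
  allOnRows = from-yes (exhaustible-Rows 3 λ rows →
    antisymmetric? (fromRows rows) →-dec nicheComplete? (fromRows rows) →-dec
    semicomplete? (fromRows rows))

fewerParts⇒¬semicomplete : ∀ {m k} (T : KPartiteTournament m k) → k < m →
                           ¬ Semicomplete (KPartiteTournament.arc T)
fewerParts⇒¬semicomplete T k<m semi with pigeonhole k<m (KPartiteTournament.part T)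
... | i , j , i<j , same with semi i j (<⇒≢ i<j)
...   | inj₁ i→j = KPartiteTournament.noArcIn T i j same i→j
...   | inj₂ j→i = KPartiteTournament.noArcIn T j i (sym same) j→i

withSource : ∀ {m} → Digraph m → Digraph (suc m)
withSource D zero    (suc _) = true
withSource D (suc u) (suc v) = D u v
withSource D _       zero    = false

withSource-sinkless : ∀ {m} {D : Digraph (suc m)} → Sinkless D → Sinkless (withSource D)
withSource-sinkless sinkless zero    = suc zero , refl
withSource-sinkless sinkless (suc u) = let w , u→w = sinkless u in suc w , u→w

withSource-nicheComplete : ∀ {m} {D : Digraph m} → Sinkless D → NicheComplete (withSource D)
withSource-nicheComplete sinkless zero zero 0≢0 = ⊥-elim (0≢0 refl)
withSource-nicheComplete sinkless zero (suc v) _ =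
  let w , v→w = sinkless v in inj₁ (suc w , refl , v→w)
withSource-nicheComplete sinkless (suc u) zero _ =
  let w , u→w = sinkless u in inj₁ (suc w , u→w , refl)
withSource-nicheComplete sinkless (suc u) (suc v) _ = inj₂ (zero , refl , refl)

addSource : ∀ {m k} → KPartiteTournament m k → KPartiteTournament (suc m) (suc k)
addSource {m} {k} T = record
  { arc      = withSource arc
  ; part     = part′
  ; nonempty = nonempty′
  ; noArcIn  = noArcIn′
  ; oriented = oriented′
  ; antisym  = antisym′
  }
  where
  open KPartiteTournament T

  part′ : Fin (suc m) → Fin (suc k)
  part′ zero    = zero
  part′ (suc u) = suc (part u)

  nonempty′ : ∀ i → ∃[ v ] part′ v ≡ i
  nonempty′ zero    = zero , refl
  nonempty′ (suc i) = let v , e = nonempty i in suc v , cong suc e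

  noArcIn′ : ∀ u v → part′ u ≡ part′ v → ¬ withSource arc u v ≡ true
  noArcIn′ zero    zero    _ ()
  noArcIn′ zero    (suc v) ()
  noArcIn′ (suc u) zero    _ ()
  noArcIn′ (suc u) (suc v) e = noArcIn u v (suc-injective e)

  oriented′ : ∀ u v → part′ u ≢ part′ v →
              withSource arc u v ≡ true ⊎ withSource arc v u ≡ true
  oriented′ zero    zero    0≢0 = ⊥-elim (0≢0 refl)
  oriented′ zero    (suc v) _   = inj₁ refl
  oriented′ (suc u) zero    _   = inj₂ refl
  oriented′ (suc u) (suc v) ne  = oriented u v (ne ∘ cong suc)

  antisym′ : Antisymmetric (withSource arc)
  antisym′ zero    zero    ()
  antisym′ zero    (suc v) _  ()
  antisym′ (suc u) zero    ()
  antisym′ (suc u) (suc v)    = antisym u v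

sinklessWithSource : ∀ {m k} → SinklessTournament (suc m) k →
                     SinklessTournament (suc (suc m)) (suc k)
sinklessWithSource (T , sinkless) = addSource T , withSource-sinkless sinkless

nicheCompleteWithSource : ∀ {m k} → SinklessTournament m k →
                          NicheCompleteTournament (suc m) (suc k)
nicheCompleteWithSource (T , sinkless) = addSource T , withSource-nicheComplete sinkless

decidedTournament : ∀ {m k} (D : Digraph m) (part : Fin m → Fin k) →
  {True (all? λ i → any? λ v → part v ≟ i)} →
  {True (all? λ u → all? λ v → part u ≟ part v →-dec ¬? (arc? D u v))} →
  {True (all? λ u → all? λ v → ¬? (part u ≟ part v) →-dec (arc? D u v ⊎-dec arc? D v u))} →
  {True (antisymmetric? D)} →
  KPartiteTournament m k
decidedTournament D part {nonempty} {noArcIn} {oriented} {antisym} = record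
  { arc      = D
  ; part     = part
  ; nonempty = toWitness nonempty
  ; noArcIn  = toWitness noArcIn
  ; oriented = toWitness oriented
  ; antisym  = toWitness antisym
  }

cycle : ∀ m .{{_ : NonZero m}} → Digraph m
cycle m u v = toℕ v ≡ᵇ suc (toℕ u) % m

triangle : SinklessTournament 3 3
triangle = decidedTournament (cycle 3) id , from-yes (sinkless? (cycle 3))

square : SinklessTournament 4 2
square = decidedTournament (cycle 4) (λ v → toℕ v mod 2) , from-yes (sinkless? (cycle 4))

sinklessTournament : ∀ j → SinklessTournament (3 + j) (3 + j)
sinklessTournament zero    = triangle
sinklessTournament (suc j) = sinklessWithSource (sinklessTournament j)

nicheComplete⇒commonNeighbour-self : ∀ {m} {D : Digraph (suc (suc m))} →
  NicheComplete D → ∀ x → CommonNeighbour D x x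
nicheComplete⇒commonNeighbour-self complete x
  with complete x (punchIn x zero) (≢-sym (punchInᵢ≢i x zero))
... | inj₁ (w , x→w , _) = inj₁ (w , x→w , x→w)
... | inj₂ (w , w→x , _) = inj₂ (w , w→x , w→x)

module _ {m n : ℕ} (c : Fin n → Fin m) (s : Fin m → Fin n) (c∘s : ∀ x → c (s x) ≡ x) where

  pullback : ∀ {k} → KPartiteTournament m k → KPartiteTournament n k
  pullback T = record
    { arc      = arc on c
    ; part     = part ∘ c
    ; nonempty = λ i → let x , e = nonempty i in s x , trans (cong part (c∘s x)) e
    ; noArcIn  = λ u v → noArcIn (c u) (c v)
    ; oriented = λ u v → oriented (c u) (c v)
    ; antisym  = λ u v → antisym (c u) (c v)
    }
    where open KPartiteTournament T

  pullback-commonNeighbour : ∀ {D : Digraph m} {u v} →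
    CommonNeighbour D (c u) (c v) → CommonNeighbour (D on c) u v
  pullback-commonNeighbour {D} {u} {v} (inj₁ (w , p , q)) =
    inj₁ (s w , subst (λ x → D (c u) x ≡ true) (sym (c∘s w)) p
              , subst (λ x → D (c v) x ≡ true) (sym (c∘s w)) q)
  pullback-commonNeighbour {D} {u} {v} (inj₂ (w , p , q)) =
    inj₂ (s w , subst (λ x → D x (c u) ≡ true) (sym (c∘s w)) p
              , subst (λ x → D x (c v) ≡ true) (sym (c∘s w)) q)

  pullback-nicheComplete : ∀ {D : Digraph m} → NicheComplete D →
    (∀ x → CommonNeighbour D x x) → NicheComplete (D on c)
  pullback-nicheComplete {D} complete self u v u≢v with c u ≟ c v
  ... | no  cu≢cv = pullback-commonNeighbour {D} (complete (c u) (c v) cu≢cv)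
  ... | yes cu≡cv =
    pullback-commonNeighbour {D} (subst (CommonNeighbour D (c u)) cu≡cv (self (c u)))

collapse : ∀ m d → Fin (suc m + d) → Fin (suc m)
collapse m d = [ id , const zero ]′ ∘ splitAt (suc m)

collapse-↑ˡ : ∀ m d x → collapse m d (x ↑ˡ d) ≡ x
collapse-↑ˡ m d x = cong [ id , const zero ]′ (splitAt-↑ˡ (suc m) x d)

enlarge : ∀ {m n k} → NicheCompleteTournament (suc (suc m)) k → suc (suc m) ≤ n →
          NicheCompleteTournament n k
enlarge {m} (T , complete) m≤n with m≤n⇒∃[o]m+o≡n m≤n
... | d , refl =
  pullback c (_↑ˡ d) (collapse-↑ˡ (suc m) d) T ,
  pullback-nicheComplete c (_↑ˡ d) (collapse-↑ˡ (suc m) d) complete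
    (nicheComplete⇒commonNeighbour-self complete)
  where
  c = collapse (suc m) d

niche≅K⇒nicheComplete : ∀ {m n} {D : Digraph m} → Niche D ≅ K n → NicheComplete D
niche≅K⇒nicheComplete iso u v u≢v =
  proj₂ (Equivalence.from (preserve u v) (u≢v ∘ injective))
  where
  open _≅_ iso
  open Injection (↔⇒↣ bij) using (injective)

nicheComplete⇒niche≅K : ∀ {m} {D : Digraph m} → NicheComplete D → Niche D ≅ K m
nicheComplete⇒niche≅K complete = record
  { bij      = ↔-id _
  ; preserve = λ u v → mk⇔ proj₁ (λ u≢v → u≢v , complete u v u≢v)
  }

nicheRealizable-K⇔nicheCompleteTournament : ∀ {n k} →
  NicheRealizable (K n) k ⇔ NicheCompleteTournament n k
nicheRealizable-K⇔nicheCompleteTournament =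
  mk⇔ to (λ (T , complete) → _ , T , nicheComplete⇒niche≅K complete)
  where
  to : ∀ {n k} → NicheRealizable (K n) k → NicheCompleteTournament n k
  to (m , T , iso) with ↔⇒≡ (_≅_.bij iso)
  ... | refl = T , niche≅K⇒nicheComplete iso

necessity : ∀ {n k} → 3 ≤ k → k ≤ n → NicheCompleteTournament n k → (n ≡ 4 × k ≡ 4) ⊎ 5 ≤ n
necessity {3} {3} _ _ (T , complete) =
  ⊥-elim (antisymmetric⇒¬nicheComplete₃ _ (KPartiteTournament.antisym T) complete)
necessity {4} {3} _ _ (T , complete) =
  ⊥-elim (fewerParts⇒¬semicomplete T (s≤s (s≤s (s≤s (s≤s z≤n))))
    (antisymmetric∧nicheComplete⇒semicomplete₄ _ (KPartiteTournament.antisym T) complete))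
necessity {4} {4} _ _ _ = inj₁ (refl , refl)
necessity {suc (suc (suc (suc (suc n))))} _ _ _ = inj₂ (s≤s (s≤s (s≤s (s≤s (s≤s z≤n)))))
necessity {k = 0} () _ _
necessity {k = 1} (s≤s ()) _ _
necessity {k = 2} (s≤s (s≤s ())) _ _
necessity {0} {suc _} _ () _
necessity {1} {suc (suc _)} _ (s≤s ()) _
necessity {2} {suc (suc (suc _))} _ (s≤s (s≤s ())) _
necessity {3} {suc (suc (suc (suc _)))} _ (s≤s (s≤s (s≤s ()))) _
necessity {4} {suc (suc (suc (suc (suc _))))} _ (s≤s (s≤s (s≤s (s≤s ())))) _

sufficiency : ∀ {n k} → 3 ≤ k → k ≤ n → (n ≡ 4 × k ≡ 4) ⊎ 5 ≤ n → NicheCompleteTournament n k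
sufficiency {k = 0} () _ _
sufficiency {k = 1} (s≤s ()) _ _
sufficiency {k = 2} (s≤s (s≤s ())) _ _
sufficiency {k = 3} _ _ (inj₁ (_ , ()))
sufficiency {k = 3} _ _ (inj₂ 5≤n) = enlarge (nicheCompleteWithSource square) 5≤n
sufficiency {k = suc (suc (suc (suc j)))} _ k≤n _ =
  enlarge (nicheCompleteWithSource (sinklessTournament j)) k≤n

theorem4p1 : (n k : ℕ) → 3 ≤ k → k ≤ n →
    (NicheRealizable (K n) k ⇔ ((n ≡ 4 × k ≡ 4) ⊎ 5 ≤ n))
theorem4p1 n k 3≤k k≤n = mk⇔
  (necessity 3≤k k≤n ∘ Equivalence.to nicheRealizable-K⇔nicheCompleteTournament)
  (Equivalence.from nicheRealizable-K⇔nicheCompleteTournament ∘ sufficiency 3≤k k≤n)
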